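{- Let $\boldsymbol{r}_1,\boldsymbol{r}_2$ be distinct dark minimal $\mathcal{I}$-degrees, represented by ceers $R_1,R_2$ respectively. Then the $\mathcal{I}$-degree $\boldsymbol{r}_1\oplus\boldsymbol{r}_2$ of $R_1\oplus R_2$ is an $\mathcal{I}$-strongly minimal cover of the pair $\boldsymbol{r}_1,\boldsymbol{r}_2$.
   Context: A ceer is a computably enumerable equivalence relation on $\omega$. $R\le S$ means there is a total computable $f$ with $x\,R\,y\iff f(x)\,S\,f(y)$. $\mathrm{Id}$ is equality on $\omega$; for $n\ge1$, $\mathrm{Id}_n$ is congruence mod $n$, $R\oplus\mathrm{Id}_0:=R$; $R\oplus S$ is the uniform join: $2u\,(R\oplus S)\,2v$ iff $u\,R\,v$, $2u+1\,(R\oplus S)\,2v+1$ iff $u\,S\,v$, no even related to an odd. A ceer is finite if it has finitely many classes, light if $\mathrm{Id}\le R$, dark if neither. $R\le_{\mathcal{I}}S$ means $R\le S\oplus\mathrm{Id}_k$ for some $k\ge0$; $\equiv_{\mathcal{I}}$ is the induced equivalence, whose classes are $\mathcal{I}$-degrees, ordered by $\le_{\mathcal{I}}$. A dark minimal $\mathcal{I}$-degree is the $\mathcal{I}$-degree of a dark ceer $R$ such that every ceer $X\le_{\mathcal{I}}R$ is finite or satisfies $R\le_{\mathcal{I}}X$. An $\mathcal{I}$-degree $\boldsymbol{a}$ is an $\mathcal{I}$-strongly minimal cover of the pair of $\mathcal{I}$-degrees $\boldsymbol{d},\boldsymbol{e}$ if $\boldsymbol{d},\boldsymbol{e}$ are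 $\le_{\mathcal{I}}$-incomparable, $\boldsymbol{d},\boldsymbol{e}<_{\mathcal{I}}\boldsymbol{a}$, and every $\mathcal{I}$-degree $<_{\mathcal{I}}\boldsymbol{a}$ is $\le_{\mathcal{I}}\boldsymbol{d}$ or $\le_{\mathcal{I}}\boldsymbol{e}$. -}

module Defs where

open import Data.Nat using (ℕ; zero; suc; _<_; _%_; _/_)
open import Data.Fin using (Fin)
open import Data.Vec using (Vec; []; _∷_; lookup)
open import Data.Product using (Σ; ∃; _×_; _,_)
open import Data.Sum using (_⊎_)
open import Data.Empty using (⊥)
open import Relation.Nullary using (¬_)
open import Relation.Binary.PropositionalEquality using (_≡_)
open import Relation.Binary.Structures using (IsEquivalence)

data PR : ℕ → Set where
  zeroF : ∀ {n} → PR n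
  succF : PR 1
  proj  : ∀ {n} → Fin n → PR n
  comp  : ∀ {m n} → PR m → Vec (PR n) m → PR n
  prec  : ∀ {n} → PR n → PR (suc (suc n)) → PR (suc n)
  mu    : ∀ {n} → PR (suc n) → PR n

-- Big-step evaluation: Eval f xs y  means  f(xs) converges with value y.
mutual
  data Eval : ∀ {n} → PR n → Vec ℕ n → ℕ → Set where
    ev-zero : ∀ {n} {xs : Vec ℕ n} → Eval zeroF xs 0
    ev-succ : ∀ {x} → Eval succF (x ∷ []) (suc x)
    ev-proj : ∀ {n} {i : Fin n} {xs : Vec ℕ n} → Eval (proj i) xs (lookup xs i)
    ev-comp : ∀ {m n} {f : PR m} {gs : Vec (PR n) m} {xs : Vec ℕ n}
                {ys : Vec ℕ m} {y : ℕ} →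
              EvalAll gs xs ys → Eval f ys y → Eval (comp f gs) xs y
    ev-prec0 : ∀ {n} {g : PR n} {h : PR (suc (suc n))} {xs : Vec ℕ n} {y : ℕ} →
               Eval g xs y → Eval (prec g h) (0 ∷ xs) y
    ev-precS : ∀ {n} {g : PR n} {h : PR (suc (suc n))} {xs : Vec ℕ n}
                 {x r y : ℕ} →
               Eval (prec g h) (x ∷ xs) r → Eval h (x ∷ r ∷ xs) y →
               Eval (prec g h) (suc x ∷ xs) y
    ev-mu : ∀ {n} {f : PR (suc n)} {xs : Vec ℕ n} {y : ℕ} →
            Eval f (y ∷ xs) 0 →
            (∀ z → z < y → ∃ λ v → Eval f (z ∷ xs) (suc v)) →
            Eval (mu f) xs y

  data EvalAll {n} : ∀ {m} → Vec (PR n) m → Vec ℕ n → Vec ℕ m → Set where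
    ev-[] : ∀ {xs} → EvalAll [] xs []
    ev-∷  : ∀ {m} {g : PR n} {gs : Vec (PR n) m} {xs} {y} {ys} →
            Eval g xs y → EvalAll gs xs ys → EvalAll (g ∷ gs) xs (y ∷ ys)

Computable : (ℕ → ℕ) → Set
Computable f = Σ (PR 1) λ c → ∀ x → Eval c (x ∷ []) (f x)

BinRel : Set₁
BinRel = ℕ → ℕ → Set

-- c.e. binary relation: the domain of a partial recursive function of arity 2
CE : BinRel → Set
CE R = Σ (PR 2) λ c → ∀ x y → (R x y → ∃ λ v → Eval c (x ∷ y ∷ []) v)
                              × ((∃ λ v → Eval c (x ∷ y ∷ []) v) → R x y)

record Ceer : Set₁ where
  field
    rel   : BinRel
    isEq  : IsEquivalence rel
    isCE  : CE rel
open Ceer public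

_≤c_ : BinRel → BinRel → Set
R ≤c S = Σ (ℕ → ℕ) λ f → Computable f ×
           (∀ x y → (R x y → S (f x) (f y)) × (S (f x) (f y) → R x y))

IdR : BinRel
IdR x y = x ≡ y

IdMod : (n : ℕ) → .{{_ : Data.Nat.NonZero n}} → BinRel
IdMod n x y = x % n ≡ y % n

_⊕_ : BinRel → BinRel → BinRel
(R ⊕ S) x y = (x % 2 ≡ 0 × y % 2 ≡ 0 × R (x / 2) (y / 2))
            ⊎ (x % 2 ≡ 1 × y % 2 ≡ 1 × S (x / 2) (y / 2))

_⊕Id_ : BinRel → ℕ → BinRel
R ⊕Id zero    = R
R ⊕Id (suc k) = R ⊕ IdMod (suc k)

_≤I_ : BinRel → BinRel → Set
R ≤I S = Σ ℕ λ k → R ≤c (S ⊕Id k)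

_<I_ : BinRel → BinRel → Set
R <I S = R ≤I S × ¬ (S ≤I R)

_≡I_ : BinRel → BinRel → Set
R ≡I S = R ≤I S × S ≤I R

-- finitely many classes: finitely many representatives cover ω
Finite : BinRel → Set
Finite R = Σ ℕ λ n → Σ (Fin n → ℕ) λ rep → ∀ x → ∃ λ i → R x (rep i)

Light : BinRel → Set
Light R = IdR ≤c R

Dark : BinRel → Set
Dark R = ¬ Finite R × ¬ Light R

DarkMinimal : Ceer → Set₁
DarkMinimal R = Dark (rel R) ×
  ((X : Ceer) → rel X ≤I rel R → Finite (rel X) ⊎ rel R ≤I rel X)

-- the I-degree of A is an I-strongly minimal cover of the pair of I-degrees of D, E
-- (degrees <I A quantified over ceers representing them)
StronglyMinimalCover : BinRel → BinRel → BinRel → Set₁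
StronglyMinimalCover A D E =
  ¬ (D ≤I E) × ¬ (E ≤I D) × D <I A × E <I A ×
  ((X : Ceer) → rel X <I A → rel X ≤I D ⊎ rel X ≤I E)

module Submission where

-- Incomparability and R₁, R₂ <I R₁ ⊕ R₂ follow directly from minimality and
-- darkness.  For the cover property let f : X ≤ (R₁ ⊕ R₂) ⊕ Id_K, and let A
-- (B) be the points that f sends into the R₁-copy (R₂-copy).  X restricted to
-- A lies below R₁, so by minimality either it has finitely many classes, and
-- computably finding the class of a point of A turns f into X ≤I R₂; or R₁
-- reduces to X with all values in A.  Symmetrically for B.  If the second case
-- occurs on both sides, the two reductions have disjoint ranges and join to
-- R₁ ⊕ R₂ ≤I X, a contradiction.
--
-- Excluded middle is used
-- for the case splits on A and on finitely many classes.

open import Defs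
open import Level using (0ℓ)
open import Axiom.ExcludedMiddle using (ExcludedMiddle)
open import Data.Nat
open import Data.Nat.Properties
open import Data.Nat.DivMod
open import Data.Fin using (Fin; zero; suc; toℕ)
open import Data.Fin.Properties using (toℕ-injective; toℕ<n)
open import Data.Vec using (Vec; []; _∷_; lookup; tabulate)
open import Data.Product
open import Data.Sum using (_⊎_; inj₁; inj₂)
open import Data.Unit using (⊤; tt)
open import Data.Empty using (⊥; ⊥-elim)
open import Relation.Nullary using (¬_; Dec; yes; no)
open import Relation.Binary.PropositionalEquality
open import Relation.Binary.Structures using (IsEquivalence)

_⇔_ : Set → Set → Set
P ⇔ Q = (P → Q) × (Q → P)

ifz : ℕ → ℕ → ℕ → ℕ
ifz zero    a b = a
ifz (suc _) a b = b

ifzCode : PR 3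
ifzCode = prec (proj zero) (proj (suc (suc (suc zero))))

ifzCode-ok : ∀ x a b → Eval ifzCode (x ∷ a ∷ b ∷ []) (ifz x a b)
ifzCode-ok zero    a b = ev-prec0 ev-proj
ifzCode-ok (suc x) a b = ev-precS (ifzCode-ok x a b) ev-proj

predCode : PR 1
predCode = prec zeroF (proj zero)

predCode-ok : ∀ x → Eval predCode (x ∷ []) (pred x)
predCode-ok zero    = ev-prec0 ev-zero
predCode-ok (suc x) = ev-precS (predCode-ok x) ev-proj

constC : ∀ {n} → ℕ → PR n
constC zero    = zeroF
constC (suc c) = comp succF (constC c ∷ [])

constE : ∀ {n} c (xs : Vec ℕ n) → Eval (constC c) xs c
constE zero    xs = ev-zero
constE (suc c) xs = ev-comp (ev-∷ (constE c xs) ev-[]) ev-succ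

sucC predC : ∀ {n} → PR n → PR n
sucC t  = comp succF (t ∷ [])
predC t = comp predCode (t ∷ [])

ifzC : ∀ {n} → PR n → PR n → PR n → PR n
ifzC t a b = comp ifzCode (t ∷ a ∷ b ∷ [])

module _ {n} {xs : Vec ℕ n} where
  sucE : ∀ {t a} → Eval t xs a → Eval (sucC t) xs (suc a)
  sucE e = ev-comp (ev-∷ e ev-[]) ev-succ

  predE : ∀ {t a} → Eval t xs a → Eval (predC t) xs (pred a)
  predE {a = a} e = ev-comp (ev-∷ e ev-[]) (predCode-ok a)

  ifzE : ∀ {t u v a b c} → Eval t xs a → Eval u xs b → Eval v xs c →
         Eval (ifzC t u v) xs (ifz a b c)
  ifzE {a = a} {b} {c} e₁ e₂ e₃ =
    ev-comp (ev-∷ e₁ (ev-∷ e₂ (ev-∷ e₃ ev-[]))) (ifzCode-ok a b c)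

projsE : ∀ {n m} (ρ : Fin n → Fin m) (ys : Vec ℕ m) (xs : Vec ℕ n) →
         (∀ i → lookup ys (ρ i) ≡ lookup xs i) →
         EvalAll (tabulate (λ i → proj (ρ i))) ys xs
projsE ρ ys []       eq = ev-[]
projsE ρ ys (x ∷ xs) eq =
  ev-∷ (subst (Eval (proj (ρ zero)) ys) (eq zero) ev-proj)
       (projsE (λ i → ρ (suc i)) ys xs (λ i → eq (suc i)))

arg0 : ∀ {n} → Fin (suc n)
arg0 = zero

arg1 : ∀ {n} → Fin (suc (suc n))
arg1 = suc zero

arg2 : ∀ {n} → Fin (suc (suc (suc n)))
arg2 = suc (suc zero)

drop1 : ∀ {n} → Vec (PR (suc n)) n
drop1 = tabulate (λ j → proj (suc j))

drop2 : ∀ {n} → Vec (PR (suc (suc n))) n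
drop2 = tabulate (λ j → proj (suc (suc j)))

drop3 : ∀ {n} → Vec (PR (suc (suc (suc n)))) n
drop3 = tabulate (λ j → proj (suc (suc (suc j))))

-- run s f xs is 0 if f(xs) has not been found to converge at stage s, and
-- suc y if it converges with value y.  The stage only bounds the search of
-- the μ-operator.  run is itself computable uniformly in the stage (runCode),
-- it is monotone in the stage, sound and complete for Eval.

-- One step of the bounded μ-search: the state is 0 while every tested
-- argument gave a positive value, suc (suc b) once b is the least zero.
-- A test that has not converged yet (value 0) stops the search with 1.
muStep : ℕ → ℕ → ℕ → ℕ
muStep st b e = ifz st (ifz e 1 (ifz (pred e) (suc (suc b)) 0)) st

mutual
  run : ∀ {n} → ℕ → PR n → Vec ℕ n → ℕ
  run s zeroF       xs         = 1
  run s succF       (x ∷ [])   = suc (suc x)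
  run s (proj i)    xs         = suc (lookup xs i)
  run s (comp f gs) xs         = ifz (argsPending s gs xs) (run s f (argValues s gs xs)) 0
  run s (prec g h)  (x ∷ xs)   = runPrec s g h xs x
  run s (mu f)      xs         = pred (runMu s f xs s)

  -- 0 iff all the argument codes have converged at stage s
  argsPending : ∀ {n m} → ℕ → Vec (PR n) m → Vec ℕ n → ℕ
  argsPending s []       xs = 0
  argsPending s (g ∷ gs) xs = ifz (run s g xs) 1 (argsPending s gs xs)

  argValues : ∀ {n m} → ℕ → Vec (PR n) m → Vec ℕ n → Vec ℕ m
  argValues s []       xs = []
  argValues s (g ∷ gs) xs = pred (run s g xs) ∷ argValues s gs xs

  runPrec : ∀ {n} → ℕ → PR n → PR (suc (suc n)) → Vec ℕ n → ℕ → ℕ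
  runPrec s g h xs zero    = run s g xs
  runPrec s g h xs (suc i) =
    ifz (runPrec s g h xs i) 0 (run s h (i ∷ pred (runPrec s g h xs i) ∷ xs))

  runMu : ∀ {n} → ℕ → PR (suc n) → Vec ℕ n → ℕ → ℕ
  runMu s f xs zero    = 0
  runMu s f xs (suc b) = muStep (runMu s f xs b) b (run s f (b ∷ xs))

mutual
  runCode : ∀ {n} → PR n → PR (suc n)
  runCode zeroF       = constC 1
  runCode succF       = sucC (sucC (proj arg1))
  runCode (proj i)    = sucC (proj (suc i))
  runCode (comp f gs) =
    ifzC (argsPendingCode gs) (comp (runCode f) (proj arg0 ∷ argValuesCode gs)) (constC 0)
  runCode (prec g h)  =
    comp (prec (runCode g) (runPrecStepCode h)) (proj arg1 ∷ proj arg0 ∷ drop2)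
  runCode (mu f)      =
    predC (comp (prec zeroF (runMuStepCode f)) (proj arg0 ∷ proj arg0 ∷ drop1))

  runPrecStepCode : ∀ {n} → PR (suc (suc n)) → PR (suc (suc (suc n)))
  runPrecStepCode h =
    ifzC (proj arg1) (constC 0)
         (comp (runCode h) (proj arg2 ∷ proj arg0 ∷ predC (proj arg1) ∷ drop3))

  runMuStepCode : ∀ {n} → PR (suc n) → PR (suc (suc (suc n)))
  runMuStepCode f =
    ifzC (proj arg1)
         (ifzC (runMuTestCode f) (constC 1)
               (ifzC (predC (runMuTestCode f)) (sucC (sucC (proj arg0))) (constC 0)))
         (proj arg1)

  runMuTestCode : ∀ {n} → PR (suc n) → PR (suc (suc (suc n)))
  runMuTestCode f = comp (runCode f) (proj arg2 ∷ proj arg0 ∷ drop3)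

  argsPendingCode : ∀ {n m} → Vec (PR n) m → PR (suc n)
  argsPendingCode []       = constC 0
  argsPendingCode (g ∷ gs) = ifzC (runCode g) (constC 1) (argsPendingCode gs)

  argValuesCode : ∀ {n m} → Vec (PR n) m → Vec (PR (suc n)) m
  argValuesCode []       = []
  argValuesCode (g ∷ gs) = predC (runCode g) ∷ argValuesCode gs

mutual
  runCodeE : ∀ {n} (f : PR n) s xs → Eval (runCode f) (s ∷ xs) (run s f xs)
  runCodeE zeroF       s xs       = constE 1 _
  runCodeE succF       s (x ∷ []) = sucE (sucE ev-proj)
  runCodeE (proj i)    s xs       = sucE ev-proj
  runCodeE (comp f gs) s xs       =
    ifzE (argsPendingCodeE gs s xs)
         (ev-comp (ev-∷ ev-proj (argValuesCodeE gs s xs)) (runCodeE f s (argValues s gs xs)))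
         (constE 0 _)
  runCodeE (prec g h)  s (x ∷ xs) =
    ev-comp (ev-∷ ev-proj (ev-∷ ev-proj (projsE _ _ xs (λ i → refl))))
            (runPrecCodeE g h s xs x)
  runCodeE (mu f)      s xs       =
    predE (ev-comp (ev-∷ ev-proj (ev-∷ ev-proj (projsE _ _ xs (λ i → refl))))
                   (runMuCodeE f s xs s))

  runPrecCodeE : ∀ {n} (g : PR n) h s xs x →
                 Eval (prec (runCode g) (runPrecStepCode h)) (x ∷ s ∷ xs) (runPrec s g h xs x)
  runPrecCodeE g h s xs zero    = ev-prec0 (runCodeE g s xs)
  runPrecCodeE g h s xs (suc i) =
    ev-precS (runPrecCodeE g h s xs i)
      (ifzE ev-proj (constE 0 _)
        (ev-comp (ev-∷ ev-proj (ev-∷ ev-proj (ev-∷ (predE ev-proj) (projsE _ _ xs (λ j → refl)))))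
                 (runCodeE h s (i ∷ pred (runPrec s g h xs i) ∷ xs))))

  runMuCodeE : ∀ {n} (f : PR (suc n)) s xs b →
               Eval (prec zeroF (runMuStepCode f)) (b ∷ s ∷ xs) (runMu s f xs b)
  runMuCodeE f s xs zero    = ev-prec0 ev-zero
  runMuCodeE f s xs (suc b) =
    ev-precS (runMuCodeE f s xs b)
      (ifzE ev-proj
            (ifzE test (constE 1 _) (ifzE (predE test) (sucE (sucE ev-proj)) (constE 0 _)))
            ev-proj)
    where
      test : Eval (runMuTestCode f) (b ∷ runMu s f xs b ∷ s ∷ xs) (run s f (b ∷ xs))
      test = ev-comp (ev-∷ ev-proj (ev-∷ ev-proj (projsE _ _ xs (λ j → refl))))
                     (runCodeE f s (b ∷ xs))

  argsPendingCodeE : ∀ {n m} (gs : Vec (PR n) m) s xs →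
                     Eval (argsPendingCode gs) (s ∷ xs) (argsPending s gs xs)
  argsPendingCodeE []       s xs = constE 0 _
  argsPendingCodeE (g ∷ gs) s xs = ifzE (runCodeE g s xs) (constE 1 _) (argsPendingCodeE gs s xs)

  argValuesCodeE : ∀ {n m} (gs : Vec (PR n) m) s xs →
                   EvalAll (argValuesCode gs) (s ∷ xs) (argValues s gs xs)
  argValuesCodeE []       s xs = ev-[]
  argValuesCodeE (g ∷ gs) s xs = ev-∷ (predE (runCodeE g s xs)) (argValuesCodeE gs s xs)

ifz-else0 : ∀ a b {y} → ifz a b 0 ≡ suc y → a ≡ 0 × b ≡ suc y
ifz-else0 zero    b e = refl , e
ifz-else0 (suc a) b ()

ifz-then0 : ∀ a c {y} → ifz a 0 c ≡ suc y → (∃ λ a' → a ≡ suc a') × c ≡ suc y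
ifz-then0 zero    c ()
ifz-then0 (suc a) c e = (a , refl) , e

pred≡suc : ∀ {a y} → pred a ≡ suc y → a ≡ suc (suc y)
pred≡suc {suc a} refl = refl

muScan : (ℕ → ℕ) → ℕ → ℕ
muScan g zero    = 0
muScan g (suc b) = muStep (muScan g b) b (g b)

runMu≡muScan : ∀ {n} s (f : PR (suc n)) xs b →
               runMu s f xs b ≡ muScan (λ z → run s f (z ∷ xs)) b
runMu≡muScan s f xs zero    = refl
runMu≡muScan s f xs (suc b) = cong (λ t → muStep t b (run s f (b ∷ xs))) (runMu≡muScan s f xs b)

PositiveBelow : (ℕ → ℕ) → ℕ → Set
PositiveBelow g y = ∀ z → z < y → ∃ λ v → g z ≡ suc (suc v)

PositiveBelow-suc : ∀ {g b} v → PositiveBelow g b → g b ≡ suc (suc v) → PositiveBelow g (suc b)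
PositiveBelow-suc {b = b} v below gb z z<sb with m≤n⇒m<n∨m≡n (s≤s⁻¹ z<sb)
... | inj₁ z<b  = below z z<b
... | inj₂ refl = v , gb

muScan-pending : ∀ g b → muScan g b ≡ 0 → PositiveBelow g b
muScan-pending g zero    e z ()
muScan-pending g (suc b) e with muScan g b in scan
... | suc m = ⊥-elim (0≢1+n (sym e))
... | zero with g b in gb
...   | zero        = ⊥-elim (0≢1+n (sym e))
...   | suc zero    = ⊥-elim (0≢1+n (sym e))
...   | suc (suc v) = PositiveBelow-suc v (muScan-pending g b scan) gb

muScan-found : ∀ g b {y} → muScan g b ≡ suc (suc y) → y < b × g y ≡ 1 × PositiveBelow g y
muScan-found g zero ()
muScan-found g (suc b) e with muScan g b in scan
... | suc m with muScan-found g b (trans scan e)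
...   | y<b , gy , below = m<n⇒m<1+n y<b , gy , below
muScan-found g (suc b) e | zero with g b in gb
...   | zero        = ⊥-elim (1+n≢0 (suc-injective (sym e)))
...   | suc (suc v) = ⊥-elim (0≢1+n e)
...   | suc zero with e
...     | refl = ≤-refl , gb , muScan-pending g b scan

muScan-pass : ∀ g b → PositiveBelow g b → muScan g b ≡ 0
muScan-pass g zero    below = refl
muScan-pass g (suc b) below
  with muScan-pass g b (λ z p → below z (m<n⇒m<1+n p)) | below b ≤-refl
... | scan | v , gb rewrite scan | gb = refl

muScan-find : ∀ g b y → y < b → g y ≡ 1 → PositiveBelow g y → muScan g b ≡ suc (suc y)
muScan-find g (suc b) y y<sb gy below with m≤n⇒m<n∨m≡n (s≤s⁻¹ y<sb)
... | inj₁ y<b  rewrite muScan-find g b y y<b gy below = refl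
... | inj₂ refl rewrite muScan-pass g b below | gy = refl

mutual
  run-mono : ∀ {n} (f : PR n) s s' xs {y} → s ≤ s' → run s f xs ≡ suc y → run s' f xs ≡ suc y
  run-mono zeroF       s s' xs       le e = e
  run-mono succF       s s' (x ∷ []) le e = e
  run-mono (proj i)    s s' xs       le e = e
  run-mono (comp f gs) s s' xs       le e with ifz-else0 (argsPending s gs xs) _ e
  ... | done , r with args-mono gs s s' xs le done
  ...   | done' , same rewrite done' | same = run-mono f s s' _ le r
  run-mono (prec g h)  s s' (x ∷ xs) le e = runPrec-mono g h s s' xs x le e
  run-mono (mu f)      s s' xs {y} le e
    with muScan-found _ s (trans (sym (runMu≡muScan s f xs s)) (pred≡suc e))
  ... | y<s , gy , below =
    cong pred (trans (runMu≡muScan s' f xs s')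
      (muScan-find _ s' y (≤-trans y<s le) (run-mono f s s' (y ∷ xs) le gy)
         (λ z p → proj₁ (below z p) , run-mono f s s' (z ∷ xs) le (proj₂ (below z p)))))

  args-mono : ∀ {n m} (gs : Vec (PR n) m) s s' xs → s ≤ s' → argsPending s gs xs ≡ 0 →
              argsPending s' gs xs ≡ 0 × argValues s' gs xs ≡ argValues s gs xs
  args-mono []       s s' xs le e = refl , refl
  args-mono (g ∷ gs) s s' xs le e with run s g xs in r
  ... | suc _ with args-mono gs s s' xs le e
  ...   | done , same rewrite run-mono g s s' xs le r | done | same = refl , refl

  runPrec-mono : ∀ {n} (g : PR n) h s s' xs x {y} → s ≤ s' →
                 runPrec s g h xs x ≡ suc y → runPrec s' g h xs x ≡ suc y
  runPrec-mono g h s s' xs zero    le e = run-mono g s s' xs le e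
  runPrec-mono g h s s' xs (suc i) le e with ifz-then0 (runPrec s g h xs i) _ e
  ... | (r , prev) , e₂ rewrite runPrec-mono g h s s' xs i le prev | prev = run-mono h s s' _ le e₂

mutual
  run-sound : ∀ {n} (f : PR n) s xs {y} → run s f xs ≡ suc y → Eval f xs y
  run-sound zeroF       s xs       refl = ev-zero
  run-sound succF       s (x ∷ []) refl = ev-succ
  run-sound (proj i)    s xs       refl = ev-proj
  run-sound (comp f gs) s xs       e with ifz-else0 (argsPending s gs xs) _ e
  ... | done , r = ev-comp (args-sound gs s xs done) (run-sound f s _ r)
  run-sound (prec g h)  s (x ∷ xs) e = runPrec-sound g h s xs x e
  run-sound (mu f)      s xs       e
    with muScan-found _ s (trans (sym (runMu≡muScan s f xs s)) (pred≡suc e))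
  ... | y<s , gy , below =
    ev-mu (run-sound f s _ gy) (λ z p → proj₁ (below z p) , run-sound f s _ (proj₂ (below z p)))

  args-sound : ∀ {n m} (gs : Vec (PR n) m) s xs → argsPending s gs xs ≡ 0 →
               EvalAll gs xs (argValues s gs xs)
  args-sound []       s xs e = ev-[]
  args-sound (g ∷ gs) s xs e with run s g xs in r
  ... | suc _ = ev-∷ (run-sound g s xs r) (args-sound gs s xs e)

  runPrec-sound : ∀ {n} (g : PR n) h s xs x {y} → runPrec s g h xs x ≡ suc y →
                  Eval (prec g h) (x ∷ xs) y
  runPrec-sound g h s xs zero    e = ev-prec0 (run-sound g s xs e)
  runPrec-sound g h s xs (suc i) e with ifz-then0 (runPrec s g h xs i) _ e
  ... | (r , prev) , e₂ rewrite prev = ev-precS (runPrec-sound g h s xs i prev) (run-sound h s _ e₂)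

compose-run : ∀ {n m} (f : PR m) (gs : Vec (PR n) m) {s xs ys y} →
              argsPending s gs xs ≡ 0 → argValues s gs xs ≡ ys →
              run s f ys ≡ suc y → run s (comp f gs) xs ≡ suc y
compose-run f gs done vals r rewrite done | vals = r

prec-run : ∀ {n} (g : PR n) h {s xs x r y} → runPrec s g h xs x ≡ suc r →
           run s h (x ∷ r ∷ xs) ≡ suc y → runPrec s g h xs (suc x) ≡ suc y
prec-run g h prev r rewrite prev = r

cons-run : ∀ {n m} (g : PR n) (gs : Vec (PR n) m) {s xs y ys} → run s g xs ≡ suc y →
           argsPending s gs xs ≡ 0 → argValues s gs xs ≡ ys →
           argsPending s (g ∷ gs) xs ≡ 0 × argValues s (g ∷ gs) xs ≡ y ∷ ys
cons-run g gs r done vals rewrite r | done | vals = refl , refl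

mutual
  run-complete : ∀ {n} {f : PR n} {xs y} → Eval f xs y → ∃ λ s → run s f xs ≡ suc y
  run-complete ev-zero = 0 , refl
  run-complete ev-succ = 0 , refl
  run-complete ev-proj = 0 , refl
  run-complete {xs = xs} (ev-comp {f = f} {gs = gs} ea ef)
    with args-complete ea | run-complete ef
  ... | s₁ , done , vals | s₂ , r with args-mono gs s₁ (s₁ ⊔ s₂) xs (m≤m⊔n s₁ s₂) done
  ...   | done' , vals' =
    s₁ ⊔ s₂ , compose-run f gs done' (trans vals' vals)
                            (run-mono f s₂ (s₁ ⊔ s₂) _ (m≤n⊔m s₁ s₂) r)
  run-complete (ev-prec0 e) = run-complete e
  run-complete (ev-precS {g = g} {h = h} {xs = xs} {x = x} e₁ e₂)
    with run-complete e₁ | run-complete e₂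
  ... | s₁ , r₁ | s₂ , r₂ =
    s₁ ⊔ s₂ , prec-run g h (runPrec-mono g h s₁ (s₁ ⊔ s₂) xs x (m≤m⊔n s₁ s₂) r₁)
                           (run-mono h s₂ (s₁ ⊔ s₂) _ (m≤n⊔m s₁ s₂) r₂)
  run-complete {xs = xs} {y = y} (ev-mu {f = f} e₀ positive)
    with run-complete e₀ | positive-complete f xs positive y ≤-refl
  ... | s₀ , r₀ | s₁ , below =
    s , cong pred (trans (runMu≡muScan s f xs s)
          (muScan-find _ s y (m≤n⊔m (s₀ ⊔ s₁) (suc y)) (run-mono f s₀ s _ s₀≤s r₀)
            (λ z p → proj₁ (below z p) , run-mono f s₁ s _ s₁≤s (proj₂ (below z p)))))
    where
      s : ℕ
      s = s₀ ⊔ s₁ ⊔ suc y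
      s₀≤s : s₀ ≤ s
      s₀≤s = ≤-trans (m≤m⊔n s₀ s₁) (m≤m⊔n (s₀ ⊔ s₁) (suc y))
      s₁≤s : s₁ ≤ s
      s₁≤s = ≤-trans (m≤n⊔m s₀ s₁) (m≤m⊔n (s₀ ⊔ s₁) (suc y))

  positive-complete : ∀ {n} (f : PR (suc n)) xs {y} →
                      (∀ z → z < y → ∃ λ v → Eval f (z ∷ xs) (suc v)) →
                      ∀ b → b ≤ y → ∃ λ s → PositiveBelow (λ z → run s f (z ∷ xs)) b
  positive-complete f xs positive zero    le = 0 , λ z ()
  positive-complete f xs positive (suc b) le
    with positive-complete f xs positive b (≤-trans (n≤1+n b) le) | positive b le
  ... | s₁ , below | v , e with run-complete e
  ...   | s₂ , r =
    s₁ ⊔ s₂ , PositiveBelow-suc v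
                (λ z p → proj₁ (below z p) ,
         run-mono f s₁ (s₁ ⊔ s₂) _ (m≤m⊔n s₁ s₂) (proj₂ (below z p)))
                (run-mono f s₂ (s₁ ⊔ s₂) _ (m≤n⊔m s₁ s₂) r)

  args-complete : ∀ {n m} {gs : Vec (PR n) m} {xs ys} → EvalAll gs xs ys →
                  ∃ λ s → argsPending s gs xs ≡ 0 × argValues s gs xs ≡ ys
  args-complete ev-[] = 0 , refl , refl
  args-complete {xs = xs} (ev-∷ {g = g} {gs = gs} e ea) with run-complete e | args-complete ea
  ... | s₁ , r | s₂ , done , vals with args-mono gs s₂ (s₁ ⊔ s₂) xs (m≤n⊔m s₁ s₂) done
  ...   | done' , vals' =
    s₁ ⊔ s₂ , cons-run g gs (run-mono g s₁ (s₁ ⊔ s₂) xs (m≤m⊔n s₁ s₂) r)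
                        done' (trans vals' vals)

eval-deterministic : ∀ {n} {f : PR n} {xs y y'} → Eval f xs y → Eval f xs y' → y ≡ y'
eval-deterministic {f = f} {xs} e e' with run-complete e | run-complete e'
... | s , r | s' , r' =
  suc-injective (trans (sym (run-mono f s (s ⊔ s') xs (m≤m⊔n s s') r))
                       (run-mono f s' (s ⊔ s') xs (m≤n⊔m s s') r'))

-- The pullback of a ceer along a computable function is a ceer: enumerate
-- X(g x, g y) by composing the enumeration of X with g; single-valuedness
-- of g makes the converse direction work.
pullback : (X : Ceer) (g : ℕ → ℕ) → Computable g → Ceer
pullback X g (cg , eg) = record
  { rel  = λ x y → rel X (g x) (g y)
  ; isEq = record { refl = X-refl ; sym = X-sym ; trans = X-trans }
  ; isCE = comp c (g₀ ∷ g₁ ∷ []) , λ x y →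
      (λ xy → let (v , e) = proj₁ (ce (g x) (g y)) xy in
              v , ev-comp (ev-∷ (gE₀ x) (ev-∷ (gE₁ y) ev-[])) e) ,
      (λ { (v , ev-comp (ev-∷ e₀ (ev-∷ e₁ ev-[])) e) →
           proj₂ (ce (g x) (g y))
             (v , subst₂ (λ s t → Eval c (s ∷ t ∷ []) v)
                         (eval-deterministic e₀ (gE₀ x)) (eval-deterministic e₁ (gE₁ y)) e) })
  }
  where
    open IsEquivalence (isEq X) renaming (refl to X-refl; sym to X-sym; trans to X-trans)
    c : PR 2
    c = proj₁ (isCE X)
    ce : ∀ x y → rel X x y ⇔ (∃ λ v → Eval c (x ∷ y ∷ []) v)
    ce = proj₂ (isCE X)
    g₀ g₁ : PR 2
    g₀ = comp cg (proj arg0 ∷ [])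
    g₁ = comp cg (proj arg1 ∷ [])
    gE₀ : ∀ x {y} → Eval g₀ (x ∷ y ∷ []) (g x)
    gE₀ x = ev-comp (ev-∷ ev-proj ev-[]) (eg x)
    gE₁ : ∀ y {x} → Eval g₁ (x ∷ y ∷ []) (g y)
    gE₁ y = ev-comp (ev-∷ ev-proj ev-[]) (eg y)

C-id : Computable (λ x → x)
C-id = proj zero , λ x → ev-proj

C-const : ∀ c → Computable (λ _ → c)
C-const c = constC c , λ x → constE c _

C-∘ : ∀ {g f} → Computable g → Computable f → Computable (λ x → g (f x))
C-∘ {g} {f} (cg , eg) (cf , ef) = comp cg (cf ∷ []) , λ x → ev-comp (ev-∷ (ef x) ev-[]) (eg (f x))

C-ifz : ∀ {t a b} → Computable t → Computable a → Computable b →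
        Computable (λ x → ifz (t x) (a x) (b x))
C-ifz (ct , et) (ca , ea) (cb , eb) = ifzC ct ca cb , λ x → ifzE (et x) (ea x) (eb x)

C-suc : ∀ {f} → Computable f → Computable (λ x → suc (f x))
C-suc (c , e) = sucC c , λ x → sucE (e x)

C-pred : ∀ {f} → Computable f → Computable (λ x → pred (f x))
C-pred (c , e) = predC c , λ x → predE (e x)

C-+ : ∀ c {f} → Computable f → Computable (λ x → c + f x)
C-+ zero    cf = cf
C-+ (suc c) cf = C-suc (C-+ c cf)

suc%2 : ∀ x → suc x % 2 ≡ ifz (x % 2) 1 0
suc%2 zero          = refl
suc%2 (suc zero)    = refl
suc%2 (suc (suc x)) = suc%2 x

2+/2 : ∀ d → suc (suc d) / 2 ≡ suc (d / 2)
2+/2 d = m/n≡1+[m∸n]/n {suc (suc d)} {2} (s≤s (s≤s z≤n))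

suc-ifz : ∀ t a b → suc (ifz t a b) ≡ ifz t (suc a) (suc b)
suc-ifz zero    a b = refl
suc-ifz (suc t) a b = refl

suc/2 : ∀ x → suc x / 2 ≡ ifz (x % 2) (x / 2) (suc (x / 2))
suc/2 zero          = refl
suc/2 (suc zero)    = refl
suc/2 (suc (suc y)) = begin
  suc (suc (suc y)) / 2                           ≡⟨ 2+/2 (suc y) ⟩
  suc (suc y / 2)                                 ≡⟨ cong suc (suc/2 y) ⟩
  suc (ifz (y % 2) (y / 2) (suc (y / 2)))         ≡⟨ suc-ifz (y % 2) _ _ ⟩
  ifz (y % 2) (suc (y / 2)) (suc (suc (y / 2)))
    ≡⟨ cong₂ (ifz (y % 2)) (sym (2+/2 y)) (cong suc (sym (2+/2 y))) ⟩
  ifz (y % 2) (suc (suc y) / 2) (suc (suc (suc y) / 2)) ∎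
  where open ≡-Reasoning

parityCode : PR 1
parityCode = prec zeroF (ifzC (proj arg1) (constC 1) (constC 0))

parityCode-ok : ∀ x → Eval parityCode (x ∷ []) (x % 2)
parityCode-ok zero    = ev-prec0 ev-zero
parityCode-ok (suc x) = subst (Eval parityCode (suc x ∷ [])) (sym (suc%2 x))
                          (ev-precS (parityCode-ok x) (ifzE ev-proj (constE 1 _) (constE 0 _)))

C-%2 : Computable (λ x → x % 2)
C-%2 = parityCode , parityCode-ok

halfCode : PR 1
halfCode = prec zeroF (ifzC (comp parityCode (proj arg0 ∷ [])) (proj arg1) (sucC (proj arg1)))

halfCode-ok : ∀ x → Eval halfCode (x ∷ []) (x / 2)
halfCode-ok zero    = ev-prec0 ev-zero
halfCode-ok (suc x) =
  subst (Eval halfCode (suc x ∷ [])) (sym (suc/2 x))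
    (ev-precS (halfCode-ok x)
      (ifzE (ev-comp (ev-∷ ev-proj ev-[]) (parityCode-ok x)) ev-proj (sucE ev-proj)))

C-/2 : Computable (λ x → x / 2)
C-/2 = halfCode , halfCode-ok

-- Remainders modulo a fixed K = suc k: the remainder of suc x wraps to 0
-- exactly when suc (x % K) reaches K.
monusCode : ℕ → PR 1
monusCode c = prec (constC c) (predC (proj arg1))

monusCode-ok : ∀ c m → Eval (monusCode c) (m ∷ []) (c ∸ m)
monusCode-ok c zero    = ev-prec0 (constE c [])
monusCode-ok c (suc m) = subst (Eval (monusCode c) (suc m ∷ [])) (pred[m∸n]≡m∸[1+n] c m)
                           (ev-precS (monusCode-ok c m) (predE ev-proj))

suc%K : ∀ k x → suc x % suc k ≡ ifz (suc k ∸ suc (x % suc k)) 0 (suc (x % suc k))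
suc%K k x = trans reduce (wrap (suc k ∸ suc (x % suc k)) refl)
  where
    K : ℕ
    K = suc k
    reduce : suc x % K ≡ suc (x % K) % K
    reduce = begin
      suc x % K                         ≡⟨ cong (λ t → suc t % K) (m≡m%n+[m/n]*n x K) ⟩
      (suc (x % K) + (x / K) * K) % K   ≡⟨ [m+kn]%n≡m%n (suc (x % K)) (x / K) K ⟩
      suc (x % K) % K                   ∎
      where open ≡-Reasoning
    wrap : ∀ t → K ∸ suc (x % K) ≡ t → suc (x % K) % K ≡ ifz t 0 (suc (x % K))
    wrap zero e with m≤n⇒m<n∨m≡n (m∸n≡0⇒m≤n e)
    ... | inj₁ K<K = ⊥-elim (<-irrefl refl (≤-trans K<K (m%n<n x K)))
    ... | inj₂ eq  = trans (cong (_% K) (sym eq)) (n%n≡0 K)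
    wrap (suc t) e = m<n⇒m%n≡m (m∸n≢0⇒n<m (λ e' → 0≢1+n (trans (sym e') e)))

modCode : ℕ → PR 1
modCode k = prec zeroF (ifzC (comp (monusCode (suc k)) (sucC (proj arg1) ∷ []))
                             (constC 0) (sucC (proj arg1)))

modCode-ok : ∀ k x → Eval (modCode k) (x ∷ []) (x % suc k)
modCode-ok k zero    = ev-prec0 ev-zero
modCode-ok k (suc x) =
  subst (Eval (modCode k) (suc x ∷ [])) (sym (suc%K k x))
    (ev-precS (modCode-ok k x)
      (ifzE (ev-comp (ev-∷ (sucE ev-proj) ev-[]) (monusCode-ok (suc k) _)) (constE 0 _) (sucE ev-proj)))

C-% : ∀ k → Computable (λ x → x % suc k)
C-% k = modCode k , modCode-ok k

dbl : ℕ → ℕ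
dbl zero    = zero
dbl (suc a) = suc (suc (dbl a))

dblCode : PR 1
dblCode = prec zeroF (sucC (sucC (proj arg1)))

dblCode-ok : ∀ x → Eval dblCode (x ∷ []) (dbl x)
dblCode-ok zero    = ev-prec0 ev-zero
dblCode-ok (suc x) = ev-precS (dblCode-ok x) (sucE (sucE ev-proj))

C-dbl : Computable dbl
C-dbl = dblCode , dblCode-ok

dbl%2 : ∀ a → dbl a % 2 ≡ 0
dbl%2 zero    = refl
dbl%2 (suc a) = dbl%2 a

sdbl%2 : ∀ a → suc (dbl a) % 2 ≡ 1
sdbl%2 zero    = refl
sdbl%2 (suc a) = sdbl%2 a

dbl/2 : ∀ a → dbl a / 2 ≡ a
dbl/2 zero    = refl
dbl/2 (suc a) = trans (2+/2 (dbl a)) (cong suc (dbl/2 a))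

sdbl/2 : ∀ a → suc (dbl a) / 2 ≡ a
sdbl/2 zero    = refl
sdbl/2 (suc a) = trans (2+/2 (suc (dbl a))) (cong suc (sdbl/2 a))

evenOdd : ∀ w → (∃ λ a → w ≡ dbl a) ⊎ (∃ λ a → w ≡ suc (dbl a))
evenOdd zero          = inj₁ (0 , refl)
evenOdd (suc zero)    = inj₂ (0 , refl)
evenOdd (suc (suc w)) with evenOdd w
... | inj₁ (a , e) = inj₁ (suc a , cong (λ t → suc (suc t)) e)
... | inj₂ (a , e) = inj₂ (suc a , cong (λ t → suc (suc t)) e)

dbl-injective : ∀ {a b} → dbl a ≡ dbl b → a ≡ b
dbl-injective {a} {b} e = trans (sym (dbl/2 a)) (trans (cong (_/ 2) e) (dbl/2 b))

sdbl-injective : ∀ {a b} → suc (dbl a) ≡ suc (dbl b) → a ≡ b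
sdbl-injective e = dbl-injective (cong pred e)

dbl≢sdbl : ∀ {a b} → dbl a ≢ suc (dbl b)
dbl≢sdbl {a} {b} e = 0≢1+n (trans (sym (dbl%2 a)) (trans (cong (_% 2) e) (sdbl%2 b)))

module _ (R S : BinRel) where
  ⊕-even→ : ∀ a b → (R ⊕ S) (dbl a) (dbl b) → R a b
  ⊕-even→ a b (inj₁ (_ , _ , r)) = subst₂ R (dbl/2 a) (dbl/2 b) r
  ⊕-even→ a b (inj₂ (p , _ , _)) = ⊥-elim (0≢1+n (trans (sym (dbl%2 a)) p))

  ⊕-even← : ∀ a b → R a b → (R ⊕ S) (dbl a) (dbl b)
  ⊕-even← a b r = inj₁ (dbl%2 a , dbl%2 b , subst₂ R (sym (dbl/2 a)) (sym (dbl/2 b)) r)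

  ⊕-odd→ : ∀ a b → (R ⊕ S) (suc (dbl a)) (suc (dbl b)) → S a b
  ⊕-odd→ a b (inj₂ (_ , _ , r)) = subst₂ S (sdbl/2 a) (sdbl/2 b) r
  ⊕-odd→ a b (inj₁ (p , _ , _)) = ⊥-elim (0≢1+n (trans (sym p) (sdbl%2 a)))

  ⊕-odd← : ∀ a b → S a b → (R ⊕ S) (suc (dbl a)) (suc (dbl b))
  ⊕-odd← a b r = inj₂ (sdbl%2 a , sdbl%2 b , subst₂ S (sym (sdbl/2 a)) (sym (sdbl/2 b)) r)

  ⊕-even-odd : ∀ a b → ¬ (R ⊕ S) (dbl a) (suc (dbl b))
  ⊕-even-odd a b (inj₁ (_ , p , _)) = ⊥-elim (0≢1+n (trans (sym p) (sdbl%2 b)))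
  ⊕-even-odd a b (inj₂ (p , _ , _)) = ⊥-elim (0≢1+n (trans (sym (dbl%2 a)) p))

  ⊕-odd-even : ∀ a b → ¬ (R ⊕ S) (suc (dbl a)) (dbl b)
  ⊕-odd-even a b (inj₁ (p , _ , _)) = ⊥-elim (0≢1+n (trans (sym p) (sdbl%2 a)))
  ⊕-odd-even a b (inj₂ (_ , p , _)) = ⊥-elim (0≢1+n (trans (sym (dbl%2 b)) p))

Reduces : BinRel → BinRel → (ℕ → ℕ) → Set
Reduces R S f = ∀ x y → R x y ⇔ S (f x) (f y)

Reduces-∘ : ∀ {R S T f g} → Reduces R S f → Reduces S T g → Reduces R T (λ x → g (f x))
Reduces-∘ {f = f} rf rg x y =
  (λ r → proj₁ (rg (f x) (f y)) (proj₁ (rf x y) r)) ,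
  (λ t → proj₂ (rf x y) (proj₂ (rg (f x) (f y)) t))

both-false : ∀ {P Q : Set} → ¬ P → ¬ Q → P ⇔ Q
both-false ¬p ¬q = (λ p → ⊥-elim (¬p p)) , (λ q → ⊥-elim (¬q q))

≤c-trans : ∀ {R S T} → R ≤c S → S ≤c T → R ≤c T
≤c-trans {S = S} {T} (f , cf , rf) (g , cg , rg) =
  (λ x → g (f x)) , C-∘ cg cf , Reduces-∘ {S = S} {T} {f} {g} rf rg

≤c-≤I-trans : ∀ {R S T} → R ≤c S → S ≤I T → R ≤I T
≤c-≤I-trans {S = S} {T} r (k , s) = k , ≤c-trans {S = S} {T ⊕Id k} r s

⊕-inl : ∀ R S → R ≤c (R ⊕ S)
⊕-inl R S = dbl , C-dbl , λ x y → ⊕-even← R S x y , ⊕-even→ R S x y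

⊕-inr : ∀ R S → S ≤c (R ⊕ S)
⊕-inr R S = (λ x → suc (dbl x)) , C-suc C-dbl , λ x y → ⊕-odd← R S x y , ⊕-odd→ R S x y

≤I-positive : ∀ {R S} k → R ≤c (S ⊕Id k) → ∃ λ k' → R ≤c (S ⊕ IdMod (suc k'))
≤I-positive {S = S} zero    r = 0 , ≤c-trans {S = S} {S ⊕ IdMod 1} r (⊕-inl S (IdMod 1))
≤I-positive         (suc k) r = k , r

mapLeft : (ℕ → ℕ) → ℕ → ℕ
mapLeft g z = ifz (z % 2) (dbl (g (z / 2))) z

C-mapLeft : ∀ {g} → Computable g → Computable (mapLeft g)
C-mapLeft cg = C-ifz C-%2 (C-∘ C-dbl (C-∘ cg C-/2)) C-id

mapLeft-even : ∀ g a → mapLeft g (dbl a) ≡ dbl (g a)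
mapLeft-even g a rewrite dbl%2 a | dbl/2 a = refl

mapLeft-odd : ∀ g c → mapLeft g (suc (dbl c)) ≡ suc (dbl c)
mapLeft-odd g c rewrite sdbl%2 c = refl

mapLeft-reduces : ∀ (S S' Q : BinRel) g → Reduces S S' g → Reduces (S ⊕ Q) (S' ⊕ Q) (mapLeft g)
mapLeft-reduces S S' Q g rg z z' with evenOdd z | evenOdd z'
... | inj₁ (a , refl) | inj₁ (b , refl) rewrite mapLeft-even g a | mapLeft-even g b =
  (λ t → ⊕-even← S' Q (g a) (g b) (proj₁ (rg a b) (⊕-even→ S Q a b t))) ,
  (λ t → ⊕-even← S Q a b (proj₂ (rg a b) (⊕-even→ S' Q (g a) (g b) t)))
... | inj₁ (a , refl) | inj₂ (b , refl) rewrite mapLeft-even g a | mapLeft-odd g b =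
  both-false (⊕-even-odd S Q a b) (⊕-even-odd S' Q (g a) b)
... | inj₂ (a , refl) | inj₁ (b , refl) rewrite mapLeft-odd g a | mapLeft-even g b =
  both-false (⊕-odd-even S Q a b) (⊕-odd-even S' Q a (g b))
... | inj₂ (a , refl) | inj₂ (b , refl) rewrite mapLeft-odd g a | mapLeft-odd g b =
  (λ t → ⊕-odd← S' Q a b (⊕-odd→ S Q a b t)) , (λ t → ⊕-odd← S Q a b (⊕-odd→ S' Q a b t))

-- A number w is in part A (the R-copy) if w = 4a, in part B (the S-copy)
-- if w = 2(2b+1), and in part C (the Id_K-copy) if w = 2c+1.

data Part : Set where
  pA pB pC : ℕ → Part

encP : Part → ℕ
encP (pA a) = dbl (dbl a)
encP (pB b) = dbl (suc (dbl b))
encP (pC c) = suc (dbl c)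

decP : ∀ w → Σ Part λ p → w ≡ encP p
decP w with evenOdd w
... | inj₂ (c , e) = pC c , e
... | inj₁ (v , e) with evenOdd v
...   | inj₁ (a , e') = pA a , trans e (cong dbl e')
...   | inj₂ (b , e') = pB b , trans e (cong dbl e')

encP-injective : ∀ p p' → encP p ≡ encP p' → p ≡ p'
encP-injective (pA a) (pA b) e = cong pA (dbl-injective (dbl-injective e))
encP-injective (pA a) (pB b) e = ⊥-elim (dbl≢sdbl (dbl-injective e))
encP-injective (pA a) (pC b) e = ⊥-elim (dbl≢sdbl e)
encP-injective (pB a) (pA b) e = ⊥-elim (dbl≢sdbl (sym (dbl-injective e)))
encP-injective (pB a) (pB b) e = cong pB (sdbl-injective (dbl-injective e))
encP-injective (pB a) (pC b) e = ⊥-elim (dbl≢sdbl e)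
encP-injective (pC a) (pA b) e = ⊥-elim (dbl≢sdbl (sym e))
encP-injective (pC a) (pB b) e = ⊥-elim (dbl≢sdbl (sym e))
encP-injective (pC a) (pC b) e = cong pC (sdbl-injective e)

pA-index : ∀ a → encP (pA a) / 2 / 2 ≡ a
pA-index a = trans (cong (_/ 2) (dbl/2 (dbl a))) (dbl/2 a)

pB-index : ∀ b → encP (pB b) / 2 / 2 ≡ b
pB-index b = trans (cong (_/ 2) (dbl/2 (suc (dbl b)))) (sdbl/2 b)

pC-index : ∀ c → encP (pC c) / 2 ≡ c
pC-index c = sdbl/2 c

PartRel : BinRel → BinRel → ℕ → Part → Part → Set
PartRel R S k (pA a) (pA b) = R a b
PartRel R S k (pB a) (pB b) = S a b
PartRel R S k (pC a) (pC b) = a % suc k ≡ b % suc k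
PartRel R S k _      _      = ⊥

module _ (R S : BinRel) (k : ℕ) where
  private
    I : BinRel
    I = IdMod (suc k)
    T : BinRel
    T = (R ⊕ S) ⊕ I

  PartRel-sound : ∀ p p' → T (encP p) (encP p') → PartRel R S k p p'
  PartRel-sound (pA a) (pA b) t = ⊕-even→ R S a b (⊕-even→ (R ⊕ S) I (dbl a) (dbl b) t)
  PartRel-sound (pA a) (pB b) t = ⊕-even-odd R S a b (⊕-even→ (R ⊕ S) I (dbl a) (suc (dbl b)) t)
  PartRel-sound (pA a) (pC b) t = ⊕-even-odd (R ⊕ S) I (dbl a) b t
  PartRel-sound (pB a) (pA b) t = ⊕-odd-even R S a b (⊕-even→ (R ⊕ S) I (suc (dbl a)) (dbl b) t)
  PartRel-sound (pB a) (pB b) t = ⊕-odd→ R S a b (⊕-even→ (R ⊕ S) I (suc (dbl a)) (suc (dbl b)) t)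
  PartRel-sound (pB a) (pC b) t = ⊕-even-odd (R ⊕ S) I (suc (dbl a)) b t
  PartRel-sound (pC a) (pA b) t = ⊕-odd-even (R ⊕ S) I a (dbl b) t
  PartRel-sound (pC a) (pB b) t = ⊕-odd-even (R ⊕ S) I a (suc (dbl b)) t
  PartRel-sound (pC a) (pC b) t = ⊕-odd→ (R ⊕ S) I a b t

  PartRel-complete : ∀ p p' → PartRel R S k p p' → T (encP p) (encP p')
  PartRel-complete (pA a) (pA b) t = ⊕-even← (R ⊕ S) I (dbl a) (dbl b) (⊕-even← R S a b t)
  PartRel-complete (pB a) (pB b) t = ⊕-even← (R ⊕ S) I (suc (dbl a)) (suc (dbl b)) (⊕-odd← R S a b t)
  PartRel-complete (pC a) (pC b) t = ⊕-odd← (R ⊕ S) I a b t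

onPart : ℕ → ℕ → ℕ → ℕ → ℕ
onPart w a b c = ifz (w % 2) (ifz ((w / 2) % 2) a b) c

selectPart : Part → ℕ → ℕ → ℕ → ℕ
selectPart (pA _) a b c = a
selectPart (pB _) a b c = b
selectPart (pC _) a b c = c

onPart-encP : ∀ p a b c → onPart (encP p) a b c ≡ selectPart p a b c
onPart-encP (pA x) a b c rewrite dbl%2 (dbl x) | dbl/2 (dbl x) | dbl%2 x = refl
onPart-encP (pB x) a b c rewrite dbl%2 (suc (dbl x)) | dbl/2 (suc (dbl x)) | sdbl%2 x = refl
onPart-encP (pC x) a b c rewrite sdbl%2 x = refl

C-onPart : ∀ {w a b c} → Computable w → Computable a → Computable b → Computable c →
           Computable (λ x → onPart (w x) (a x) (b x) (c x))
C-onPart cw ca cb cc = C-ifz (C-∘ C-%2 cw) (C-ifz (C-∘ C-%2 (C-∘ C-/2 cw)) ca cb) cc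

swapPart : Part → Part
swapPart (pA a) = pB a
swapPart (pB a) = pA a
swapPart (pC a) = pC a

swapAB : ℕ → ℕ
swapAB w = onPart w (suc (suc w)) (pred (pred w)) w

C-swapAB : Computable swapAB
C-swapAB = C-onPart C-id (C-suc (C-suc C-id)) (C-pred (C-pred C-id)) C-id

swapAB-encP : ∀ p → swapAB (encP p) ≡ encP (swapPart p)
swapAB-encP (pA a) = onPart-encP (pA a) _ _ _
swapAB-encP (pB a) = onPart-encP (pB a) _ _ _
swapAB-encP (pC a) = onPart-encP (pC a) _ _ _

PartRel-swap : ∀ R S k p p' → PartRel R S k p p' ⇔ PartRel S R k (swapPart p) (swapPart p')
PartRel-swap R S k (pA a) (pA b) = (λ t → t) , (λ t → t)
PartRel-swap R S k (pA a) (pB b) = (λ t → t) , (λ t → t)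
PartRel-swap R S k (pA a) (pC b) = (λ t → t) , (λ t → t)
PartRel-swap R S k (pB a) (pA b) = (λ t → t) , (λ t → t)
PartRel-swap R S k (pB a) (pB b) = (λ t → t) , (λ t → t)
PartRel-swap R S k (pB a) (pC b) = (λ t → t) , (λ t → t)
PartRel-swap R S k (pC a) (pA b) = (λ t → t) , (λ t → t)
PartRel-swap R S k (pC a) (pB b) = (λ t → t) , (λ t → t)
PartRel-swap R S k (pC a) (pC b) = (λ t → t) , (λ t → t)

swapPart-involutive : ∀ p → swapPart (swapPart p) ≡ p
swapPart-involutive (pA a) = refl
swapPart-involutive (pB a) = refl
swapPart-involutive (pC a) = refl

swapAB-to-A : ∀ w a → swapAB w ≡ encP (pA a) → w ≡ encP (pB a)
swapAB-to-A w a e with decP w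
... | p , refl = cong encP (begin
  p                        ≡⟨ sym (swapPart-involutive p) ⟩
  swapPart (swapPart p)    ≡⟨ cong swapPart (encP-injective _ _ (trans (sym (swapAB-encP p)) e)) ⟩
  pB a                     ∎)
  where open ≡-Reasoning

swapAB-reduces : ∀ R S k → Reduces ((R ⊕ S) ⊕ IdMod (suc k)) ((S ⊕ R) ⊕ IdMod (suc k)) swapAB
swapAB-reduces R S k w w' with decP w | decP w'
... | p , refl | p' , refl =
  (λ t → subst₂ T' (sym (swapAB-encP p)) (sym (swapAB-encP p'))
           (PartRel-complete S R k (swapPart p) (swapPart p')
             (proj₁ (PartRel-swap R S k p p') (PartRel-sound R S k p p' t)))) ,
  (λ t → PartRel-complete R S k p p'
           (proj₂ (PartRel-swap R S k p p')
             (PartRel-sound S R k (swapPart p) (swapPart p')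
               (subst₂ T' (swapAB-encP p) (swapAB-encP p') t))))
  where T' = (S ⊕ R) ⊕ IdMod (suc k)

-- To build a reduction into S ⊕ Id_M it suffices to send each point either
-- to an S-point or to a label below M, computably, respecting the relation
-- "same S-class or same label".

data Out : Set where
  inS   : ℕ → Out
  label : ℕ → Out

encO : Out → ℕ
encO (inS a)   = dbl a
encO (label j) = suc (dbl j)

LabelBelow : ℕ → Out → Set
LabelBelow M (inS _)   = ⊤
LabelBelow M (label j) = j < M

OutRel : BinRel → Out → Out → Set
OutRel S (inS a)   (inS b)   = S a b
OutRel S (label i) (label j) = i ≡ j
OutRel S _         _         = ⊥

module _ (S : BinRel) (m : ℕ) where
  private
    T : BinRel
    T = S ⊕ IdMod (suc m)

  OutRel-sound : ∀ o o' → LabelBelow (suc m) o → LabelBelow (suc m) o' →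
                 T (encO o) (encO o') → OutRel S o o'
  OutRel-sound (inS a)   (inS b)   _  _  t = ⊕-even→ S (IdMod (suc m)) a b t
  OutRel-sound (inS a)   (label b) _  _  t = ⊕-even-odd S (IdMod (suc m)) a b t
  OutRel-sound (label a) (inS b)   _  _  t = ⊕-odd-even S (IdMod (suc m)) a b t
  OutRel-sound (label a) (label b) ba bb t =
    trans (sym (m<n⇒m%n≡m ba)) (trans (⊕-odd→ S (IdMod (suc m)) a b t) (m<n⇒m%n≡m bb))

  OutRel-complete : ∀ o o' → OutRel S o o' → T (encO o) (encO o')
  OutRel-complete (inS a)   (inS b)   t    = ⊕-even← S (IdMod (suc m)) a b t
  OutRel-complete (label a) (label b) refl = ⊕-odd← S (IdMod (suc m)) a b refl

  labelled-reduction : ∀ {X : BinRel} (q : ℕ → ℕ) (out : ℕ → Out) → Computable q →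
                       (∀ x → q x ≡ encO (out x)) → (∀ x → LabelBelow (suc m) (out x)) →
                       (∀ x y → X x y ⇔ OutRel S (out x) (out y)) → X ≤I S
  labelled-reduction q out cq q-out below same = suc m , q , cq , λ x y →
    (λ r → subst₂ T (sym (q-out x)) (sym (q-out y))
             (OutRel-complete (out x) (out y) (proj₁ (same x y) r))) ,
    (λ t → proj₂ (same x y)
             (OutRel-sound (out x) (out y) (below x) (below y) (subst₂ T (q-out x) (q-out y) t)))

ifzOut : ℕ → Out → Out → Out
ifzOut zero    a b = a
ifzOut (suc _) a b = b

encO-ifzOut : ∀ t a b → encO (ifzOut t a b) ≡ ifz t (encO a) (encO b)
encO-ifzOut zero    a b = refl
encO-ifzOut (suc t) a b = refl

LabelBelow-ifzOut : ∀ M t a b → LabelBelow M a → LabelBelow M b → LabelBelow M (ifzOut t a b)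
LabelBelow-ifzOut M zero    a b ba bb = ba
LabelBelow-ifzOut M (suc t) a b ba bb = bb

shifted : ℕ → ℕ → ℕ → Out
shifted off k z = ifzOut (z % 2) (inS (z / 2)) (label (off + (z / 2) % suc k))

shiftedNum : ℕ → ℕ → ℕ → ℕ
shiftedNum off k z = ifz (z % 2) (dbl (z / 2)) (suc (dbl (off + (z / 2) % suc k)))

encO-shifted : ∀ off k z → encO (shifted off k z) ≡ shiftedNum off k z
encO-shifted off k z = encO-ifzOut (z % 2) _ _

C-shiftedNum : ∀ off k {g} → Computable g → Computable (λ x → shiftedNum off k (g x))
C-shiftedNum off k cg =
  C-ifz (C-∘ C-%2 cg) (C-∘ C-dbl (C-∘ C-/2 cg))
        (C-suc (C-∘ C-dbl (C-+ off (C-∘ (C-% k) (C-∘ C-/2 cg)))))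

shifted-even : ∀ off k t → shifted off k (dbl t) ≡ inS t
shifted-even off k t rewrite dbl%2 t | dbl/2 t = refl

shifted-odd : ∀ off k c → shifted off k (suc (dbl c)) ≡ label (off + c % suc k)
shifted-odd off k c rewrite sdbl%2 c | sdbl/2 c = refl

shifted-below : ∀ M off k z → off + suc k ≤ M → LabelBelow M (shifted off k z)
shifted-below M off k z le =
  LabelBelow-ifzOut M (z % 2) (inS (z / 2)) (label (off + (z / 2) % suc k)) tt
    (≤-trans (+-monoʳ-< off (m%n<n (z / 2) (suc k))) le)

shifted-faithful : ∀ (S : BinRel) off k z z' →
                   (S ⊕ IdMod (suc k)) z z' ⇔ OutRel S (shifted off k z) (shifted off k z')
shifted-faithful S off k z z' with evenOdd z | evenOdd z'
... | inj₁ (a , refl) | inj₁ (b , refl) rewrite shifted-even off k a | shifted-even off k b =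
  ⊕-even→ S (IdMod (suc k)) a b , ⊕-even← S (IdMod (suc k)) a b
... | inj₁ (a , refl) | inj₂ (b , refl) rewrite shifted-even off k a | shifted-odd off k b =
  ⊕-even-odd S (IdMod (suc k)) a b , λ ()
... | inj₂ (a , refl) | inj₁ (b , refl) rewrite shifted-odd off k a | shifted-even off k b =
  ⊕-odd-even S (IdMod (suc k)) a b , λ ()
... | inj₂ (a , refl) | inj₂ (b , refl) rewrite shifted-odd off k a | shifted-odd off k b =
  (λ t → cong (off +_) (⊕-odd→ S (IdMod (suc k)) a b t)) ,
  (λ e → ⊕-odd← S (IdMod (suc k)) a b (+-cancelˡ-≡ off _ _ e))

-- Two I-reductions into a symmetric S whose S-values are never S-related
-- combine into an I-reduction of the join: the Id-labels of the second are
-- shifted past those of the first.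
module JoinReductions (R T S : BinRel) (S-sym : ∀ {a b} → S a b → S b a)
    (k₁ : ℕ) (p₁ : ℕ → ℕ) (Cp₁ : Computable p₁) (rp₁ : Reduces R (S ⊕ IdMod (suc k₁)) p₁)
    (k₂ : ℕ) (p₂ : ℕ → ℕ) (Cp₂ : Computable p₂) (rp₂ : Reduces T (S ⊕ IdMod (suc k₂)) p₂)
    (apart : ∀ u v a b → p₁ u ≡ dbl a → p₂ v ≡ dbl b → ¬ S a b) where
  private
    K₁ : ℕ
    K₁ = suc k₁
    m : ℕ
    m = k₁ + suc k₂

    out : ℕ → Out
    out w = ifzOut (w % 2) (shifted 0 k₁ (p₁ (w / 2))) (shifted K₁ k₂ (p₂ (w / 2)))

    q : ℕ → ℕ
    q w = ifz (w % 2) (shiftedNum 0 k₁ (p₁ (w / 2))) (shiftedNum K₁ k₂ (p₂ (w / 2)))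

    q-out : ∀ w → q w ≡ encO (out w)
    q-out w = sym (trans (encO-ifzOut (w % 2) _ _)
                 (cong₂ (ifz (w % 2)) (encO-shifted 0 k₁ (p₁ (w / 2)))
                     (encO-shifted K₁ k₂ (p₂ (w / 2)))))

    out-below : ∀ w → LabelBelow (suc m) (out w)
    out-below w = LabelBelow-ifzOut (suc m) (w % 2) _ _
                    (shifted-below (suc m) 0 k₁ (p₁ (w / 2)) (m≤m+n K₁ (suc k₂)))
                    (shifted-below (suc m) K₁ k₂ (p₂ (w / 2)) ≤-refl)

    out-even : ∀ u → out (dbl u) ≡ shifted 0 k₁ (p₁ u)
    out-even u rewrite dbl%2 u | dbl/2 u = refl

    out-odd : ∀ v → out (suc (dbl v)) ≡ shifted K₁ k₂ (p₂ v)
    out-odd v rewrite sdbl%2 v | sdbl/2 v = refl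

    separated : ∀ u v → ¬ OutRel S (shifted 0 k₁ (p₁ u)) (shifted K₁ k₂ (p₂ v))
    separated u v o with evenOdd (p₁ u) | evenOdd (p₂ v)
    ... | inj₁ (a , ea) | inj₁ (b , eb) rewrite ea | eb | shifted-even 0 k₁ a | shifted-even K₁ k₂ b =
      apart u v a b ea eb o
    ... | inj₁ (a , ea) | inj₂ (b , eb) rewrite ea | eb | shifted-even 0 k₁ a | shifted-odd K₁ k₂ b = o
    ... | inj₂ (a , ea) | inj₁ (b , eb) rewrite ea | eb | shifted-odd 0 k₁ a | shifted-even K₁ k₂ b = o
    ... | inj₂ (a , ea) | inj₂ (b , eb) rewrite ea | eb | shifted-odd 0 k₁ a | shifted-odd K₁ k₂ b =
      <-irrefl refl (≤-trans (subst (_< K₁) o (m%n<n a K₁)) (m≤m+n K₁ (b % suc k₂)))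

    OutRel-sym : ∀ o o' → OutRel S o o' → OutRel S o' o
    OutRel-sym (inS a)   (inS b)   r = S-sym r
    OutRel-sym (label a) (label b) r = sym r

    faithful : ∀ w w' → (R ⊕ T) w w' ⇔ OutRel S (out w) (out w')
    faithful w w' with evenOdd w | evenOdd w'
    ... | inj₁ (u , refl) | inj₁ (u' , refl) rewrite out-even u | out-even u' =
      (λ t → proj₁ (shifted-faithful S 0 k₁ (p₁ u) (p₁ u'))
                   (proj₁ (rp₁ u u') (⊕-even→ R T u u' t))) ,
      (λ o → ⊕-even← R T u u'
               (proj₂ (rp₁ u u') (proj₂ (shifted-faithful S 0 k₁ (p₁ u) (p₁ u')) o)))
    ... | inj₁ (u , refl) | inj₂ (v , refl) rewrite out-even u | out-odd v =
      (λ t → ⊥-elim (⊕-even-odd R T u v t)) , (λ o → ⊥-elim (separated u v o))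
    ... | inj₂ (v , refl) | inj₁ (u , refl) rewrite out-odd v | out-even u =
      (λ t → ⊥-elim (⊕-odd-even R T v u t)) ,
      (λ o → ⊥-elim (separated u v (OutRel-sym (shifted K₁ k₂ (p₂ v)) (shifted 0 k₁ (p₁ u)) o)))
    ... | inj₂ (v , refl) | inj₂ (v' , refl) rewrite out-odd v | out-odd v' =
      (λ t → proj₁ (shifted-faithful S K₁ k₂ (p₂ v) (p₂ v'))
                   (proj₁ (rp₂ v v') (⊕-odd→ R T v v' t))) ,
      (λ o → ⊕-odd← R T v v'
               (proj₂ (rp₂ v v') (proj₂ (shifted-faithful S K₁ k₂ (p₂ v) (p₂ v')) o)))

  join-≤I : (R ⊕ T) ≤I S
  join-≤I = labelled-reduction S m q out
              (C-ifz C-%2 (C-shiftedNum 0 k₁ (C-∘ Cp₁ C-/2)) (C-shiftedNum K₁ k₂ (C-∘ Cp₂ C-/2)))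
              q-out out-below faithful

least : (P : ℕ → Set) → (∀ u → Dec (P u)) → ∀ u₀ → P u₀ →
        ∃ λ u → P u × (∀ z → z < u → ¬ P z)
least P P? u₀ pu₀ = go 0 (λ z ()) u₀ (+-identityʳ u₀)
  where
    -- invariant: nothing below b satisfies P, and u₀ = d + b
    go : ∀ b → (∀ z → z < b → ¬ P z) → ∀ d → d + b ≡ u₀ →
         ∃ λ u → P u × (∀ z → z < u → ¬ P z)
    go b none d e with P? b
    ... | yes pb = b , pb , none
    go b none zero    e | no ¬pb = ⊥-elim (¬pb (subst P (sym e) pu₀))
    go b none (suc d) e | no ¬pb = go (suc b) none' d (trans (+-suc d b) e)
      where
        none' : ∀ z → z < suc b → ¬ P z
        none' z z<sb with m≤n⇒m<n∨m≡n (s≤s⁻¹ z<sb)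
        ... | inj₁ z<b  = none z z<b
        ... | inj₂ refl = ¬pb

PairwiseInequivalent : BinRel → ∀ {m} → (Fin m → ℕ) → Set
PairwiseInequivalent X r = ∀ j j' → X (r j) (r j') → j ≡ j'

module _ (em : ExcludedMiddle 0ℓ) (X : BinRel) (X-eq : IsEquivalence X) where
  open IsEquivalence X-eq renaming (refl to X-refl; sym to X-sym)

  distinct-representatives : ∀ n (rep : Fin n → ℕ) → ∃ λ m → Σ (Fin m → ℕ) λ r →
    (∀ i → Σ (Fin m) λ j → X (rep i) (r j)) × PairwiseInequivalent X r
  distinct-representatives zero    rep = 0 , (λ ()) , (λ ()) , (λ ())
  distinct-representatives (suc n) rep with distinct-representatives n (λ i → rep (suc i))
  ... | m , r , covers , distinct with em {Σ (Fin m) λ j → X (rep zero) (r j)}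
  ...   | yes (j , x) = m , r , covers' , distinct
    where
      covers' : ∀ i → Σ (Fin m) λ j → X (rep i) (r j)
      covers' zero    = j , x
      covers' (suc i) = covers i
  ...   | no new = suc m , r' , covers' , distinct'
    where
      r' : Fin (suc m) → ℕ
      r' zero    = rep zero
      r' (suc j) = r j
      covers' : ∀ i → Σ (Fin (suc m)) λ j → X (rep i) (r' j)
      covers' zero    = zero , X-refl
      covers' (suc i) = suc (proj₁ (covers i)) , proj₂ (covers i)
      distinct' : PairwiseInequivalent X r'
      distinct' zero    zero    _ = refl
      distinct' zero    (suc j) x = ⊥-elim (new (j , x))
      distinct' (suc j) zero    x = ⊥-elim (new (j , X-sym x))
      distinct' (suc j) (suc j') x = cong suc (distinct j j' x)

-- Effective classification: if the values of a computable g all lie in the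
-- c.e. relation X with one of finitely many representatives, then an index
-- of such a representative is computable from x.  The index is found by an
-- unbounded search for a stage at which some enumeration X(g x, rep i) halts.
module Classify (X : BinRel) (c : PR 2) (ce : ∀ x y → X x y ⇔ (∃ λ v → Eval c (x ∷ y ∷ []) v))
    (n : ℕ) (rep : Fin n → ℕ) (g : ℕ → ℕ) (Cg : Computable g)
    (covered : ∀ x → Σ (Fin n) λ i → X (g x) (rep i)) where
  private
    hit : ℕ → ℕ → ℕ → ℕ
    hit r u x = run u c (x ∷ r ∷ [])

    hitC : ℕ → PR 2
    hitC r = comp (runCode c) (proj arg0 ∷ proj arg1 ∷ constC r ∷ [])

    hitC-ok : ∀ r u x → Eval (hitC r) (u ∷ x ∷ []) (hit r u x)
    hitC-ok r u x = ev-comp (ev-∷ ev-proj (ev-∷ ev-proj (ev-∷ (constE r _) ev-[])))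
                            (runCodeE c u (x ∷ r ∷ []))

    -- 0 iff some representative has been hit; then which one
    anyHit whichHit : ∀ m → (Fin m → ℕ) → ℕ → ℕ → ℕ
    anyHit zero    rs u x = 1
    anyHit (suc m) rs u x = ifz (hit (rs zero) u x) (anyHit m (λ i → rs (suc i)) u x) 0
    whichHit zero    rs u x = 0
    whichHit (suc m) rs u x = ifz (hit (rs zero) u x) (suc (whichHit m (λ i → rs (suc i)) u x)) 0

    anyHitC whichHitC : ∀ m → (Fin m → ℕ) → PR 2
    anyHitC zero    rs = constC 1
    anyHitC (suc m) rs = ifzC (hitC (rs zero)) (anyHitC m (λ i → rs (suc i))) (constC 0)
    whichHitC zero    rs = constC 0
    whichHitC (suc m) rs = ifzC (hitC (rs zero)) (sucC (whichHitC m (λ i → rs (suc i)))) (constC 0)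

    anyHitC-ok : ∀ m rs u x → Eval (anyHitC m rs) (u ∷ x ∷ []) (anyHit m rs u x)
    anyHitC-ok zero    rs u x = constE 1 _
    anyHitC-ok (suc m) rs u x = ifzE (hitC-ok _ u x) (anyHitC-ok m _ u x) (constE 0 _)

    whichHitC-ok : ∀ m rs u x → Eval (whichHitC m rs) (u ∷ x ∷ []) (whichHit m rs u x)
    whichHitC-ok zero    rs u x = constE 0 _
    whichHitC-ok (suc m) rs u x = ifzE (hitC-ok _ u x) (sucE (whichHitC-ok m _ u x)) (constE 0 _)

    anyHit-intro : ∀ m rs u x (i : Fin m) v → hit (rs i) u x ≡ suc v → anyHit m rs u x ≡ 0
    anyHit-intro (suc m) rs u x zero    v e rewrite e = refl
    anyHit-intro (suc m) rs u x (suc i) v e with hit (rs zero) u x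
    ... | zero  = anyHit-intro m (λ j → rs (suc j)) u x i v e
    ... | suc _ = refl

    whichHit-spec : ∀ m rs u x → anyHit m rs u x ≡ 0 →
                    Σ (Fin m) λ i → whichHit m rs u x ≡ toℕ i × ∃ λ v → hit (rs i) u x ≡ suc v
    whichHit-spec zero    rs u x ()
    whichHit-spec (suc m) rs u x e with hit (rs zero) u x in h
    ... | suc v = zero , refl , v , h
    ... | zero with whichHit-spec m (λ j → rs (suc j)) u x e
    ...   | i , w , hi = suc i , cong suc w , hi

    firstStage : ∀ x → ∃ λ u → anyHit n rep u (g x) ≡ 0 ×
                               (∀ z → z < u → ¬ anyHit n rep z (g x) ≡ 0)
    firstStage x with covered x
    ... | i , xi with run-complete (proj₂ (proj₁ (ce (g x) (rep i)) xi))
    ...   | s , r = least (λ u → anyHit n rep u (g x) ≡ 0) (λ u → anyHit n rep u (g x) ≟ 0)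
                          s (anyHit-intro n rep s (g x) i _ r)

    positive : ∀ {a} → ¬ a ≡ 0 → ∃ λ v → a ≡ suc v
    positive {zero}  a≢0 = ⊥-elim (a≢0 refl)
    positive {suc a} a≢0 = a , refl

    firstStageE : ∀ x → Eval (comp (mu (anyHitC n rep)) (proj₁ Cg ∷ [])) (x ∷ []) (proj₁ (firstStage x))
    firstStageE x with firstStage x
    ... | u , found , before =
      ev-comp (ev-∷ (proj₂ Cg x) ev-[])
        (ev-mu (subst (Eval (anyHitC n rep) (u ∷ g x ∷ [])) found (anyHitC-ok n rep u (g x)))
               (λ z z<u → let (v , e) = positive (before z z<u) in
                  v , subst (Eval (anyHitC n rep) (z ∷ g x ∷ [])) e (anyHitC-ok n rep z (g x))))

  classOf : ℕ → ℕ
  classOf x = whichHit n rep (proj₁ (firstStage x)) (g x)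

  C-classOf : Computable classOf
  C-classOf = comp (whichHitC n rep) (comp (mu (anyHitC n rep)) (proj₁ Cg ∷ []) ∷ proj₁ Cg ∷ []) ,
              λ x → ev-comp (ev-∷ (firstStageE x) (ev-∷ (proj₂ Cg x) ev-[]))
                            (whichHitC-ok n rep _ _)

  classOf-spec : ∀ x → Σ (Fin n) λ i → classOf x ≡ toℕ i × X (g x) (rep i)
  classOf-spec x with whichHit-spec n rep (proj₁ (firstStage x)) (g x) (proj₁ (proj₂ (firstStage x)))
  ... | i , w , v , r = i , w , proj₂ (ce (g x) (rep i)) (v , run-sound c _ _ r)

MinimalAbove : BinRel → Set₁
MinimalAbove R = (Y : Ceer) → rel Y ≤I R → Finite (rel Y) ⊎ R ≤I rel Y

module Analysis (em : ExcludedMiddle 0ℓ) (R₁ R₂ : BinRel) (X : Ceer) (k : ℕ) (f : ℕ → ℕ)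
    (Cf : Computable f) (rf : Reduces (rel X) ((R₁ ⊕ R₂) ⊕ IdMod (suc k)) f) where
  private
    Xr : BinRel
    Xr = rel X
    K : ℕ
    K = suc k
  open IsEquivalence (isEq X) renaming (refl to X-refl; sym to X-sym; trans to X-trans)

  f-parts : ∀ x y p p' → f x ≡ encP p → f y ≡ encP p' → Xr x y ⇔ PartRel R₁ R₂ k p p'
  f-parts x y p p' ex ey =
    (λ r → PartRel-sound R₁ R₂ k p p' (subst₂ T ex ey (proj₁ (rf x y) r))) ,
    (λ t → proj₂ (rf x y) (subst₂ T (sym ex) (sym ey) (PartRel-complete R₁ R₂ k p p' t)))
    where T = (R₁ ⊕ R₂) ⊕ IdMod K

  InA : ℕ → Set
  InA x = ∃ λ a → f x ≡ encP (pA a)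

  -- If a computable cls names, for x in A, one of pairwise inequivalent
  -- representatives r of the class of x, then X ≤I R₂: A is sent to the
  -- labels K, ..., K + m - 1, the R₂-copy to R₂, and the Id_K-copy to labels < K.
  private
    module FinitelyManyOnA (m : ℕ) (r : Fin m → ℕ) (distinct : PairwiseInequivalent Xr r)
        (cls : ℕ → ℕ) (Ccls : Computable cls)
        (cls-spec : ∀ x → InA x → Σ (Fin m) λ j → cls x ≡ toℕ j × Xr x (r j)) where
      out : Part → ℕ → Out
      out (pA a) x = label (K + cls x)
      out (pB b) x = inS b
      out (pC c) x = label (c % K)

      q : ℕ → ℕ
      q x = onPart (f x) (suc (dbl (K + cls x))) (dbl (f x / 2 / 2)) (suc (dbl (f x / 2 % K)))

      Cq : Computable q
      Cq = C-onPart Cf (C-suc (C-∘ C-dbl (C-+ K Ccls))) (C-∘ C-dbl (C-∘ C-/2 (C-∘ C-/2 Cf)))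
                       (C-suc (C-∘ C-dbl (C-∘ (C-% k) (C-∘ C-/2 Cf))))

      q-out : ∀ x p → f x ≡ encP p → q x ≡ encO (out p x)
      q-out x p@(pA a) e rewrite e = onPart-encP p _ _ _
      q-out x p@(pB b) e rewrite e = trans (onPart-encP p _ _ _) (cong dbl (pB-index b))
      q-out x p@(pC c) e rewrite e = trans (onPart-encP p _ _ _) (cong (λ t → suc (dbl (t % K))) (pC-index c))

      out-below : ∀ x p → f x ≡ encP p → LabelBelow (suc (k + m)) (out p x)
      out-below x (pA a) e with cls-spec x (a , e)
      ... | j , cj , _ rewrite cj = +-monoʳ-< K (toℕ<n j)
      out-below x (pB b) e = tt
      out-below x (pC c) e = ≤-trans (m%n<n c K) (m≤m+n K m)

      A≠C : ∀ x c → K + cls x ≢ c % K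
      A≠C x c e = <-irrefl refl (≤-trans (subst (_< K) (sym e) (m%n<n c K)) (m≤m+n K (cls x)))

      same-class : ∀ x y → InA x → InA y → Xr x y ⇔ (K + cls x ≡ K + cls y)
      same-class x y ax ay with cls-spec x ax | cls-spec y ay
      ... | j , cj , xj | j' , cj' , yj' =
        (λ xy → cong (K +_) (trans cj (trans (cong toℕ (distinct j j' (X-trans (X-sym xj) (X-trans xy yj'))))
                                             (sym cj')))) ,
        (λ e → let j≡j' = toℕ-injective (trans (sym cj) (trans (+-cancelˡ-≡ K _ _ e) cj')) in
               X-trans xj (X-sym (subst (λ t → Xr y (r t)) (sym j≡j') yj')))

      faithful : ∀ x y p p' → f x ≡ encP p → f y ≡ encP p' → Xr x y ⇔ OutRel R₂ (out p x) (out p' y)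
      faithful x y (pA a) (pA a') ex ey = same-class x y (a , ex) (a' , ey)
      faithful x y (pB a) (pB a') ex ey = f-parts x y (pB a) (pB a') ex ey
      faithful x y (pC a) (pC a') ex ey = f-parts x y (pC a) (pC a') ex ey
      faithful x y (pA a) (pB a') ex ey = both-false (proj₁ (f-parts x y (pA a) (pB a') ex ey)) (λ ())
      faithful x y (pA a) (pC a') ex ey = both-false (proj₁ (f-parts x y (pA a) (pC a') ex ey)) (A≠C x a')
      faithful x y (pB a) (pA a') ex ey = both-false (proj₁ (f-parts x y (pB a) (pA a') ex ey)) (λ ())
      faithful x y (pB a) (pC a') ex ey = both-false (proj₁ (f-parts x y (pB a) (pC a') ex ey)) (λ ())
      faithful x y (pC a) (pA a') ex ey =
        both-false (proj₁ (f-parts x y (pC a) (pA a') ex ey)) (λ e → A≠C y a (sym e))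
      faithful x y (pC a) (pB a') ex ey = both-false (proj₁ (f-parts x y (pC a) (pB a') ex ey)) (λ ())

      part : ℕ → Part
      part x = proj₁ (decP (f x))

      part-spec : ∀ x → f x ≡ encP (part x)
      part-spec x = proj₂ (decP (f x))

      X≤I-R₂ : Xr ≤I R₂
      X≤I-R₂ = labelled-reduction R₂ (k + m) q (λ x → out (part x) x) Cq
                 (λ x → q-out x (part x) (part-spec x))
                 (λ x → out-below x (part x) (part-spec x))
                 (λ x y → faithful x y (part x) (part y) (part-spec x) (part-spec y))

  retract : ℕ → ℕ → ℕ
  retract c x = onPart (f x) x c c

  C-retract : ∀ c → Computable (retract c)
  C-retract c = C-onPart Cf C-id (C-const c) (C-const c)

  retract-A : ∀ c x → InA x → retract c x ≡ x
  retract-A c x (a , e) rewrite e = onPart-encP (pA a) x c c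

  retract-cases : ∀ c x → (InA x × retract c x ≡ x) ⊎ retract c x ≡ c
  retract-cases c x with decP (f x)
  ... | pA a , e = inj₁ ((a , e) , retract-A c x (a , e))
  ... | pB b , e rewrite e = inj₂ (onPart-encP (pB b) x c c)
  ... | pC c' , e rewrite e = inj₂ (onPart-encP (pC c') x c c)

  finite-on-A : ∀ n (rep : Fin n → ℕ) → (∀ x → InA x → Σ (Fin n) λ i → Xr x (rep i)) →
                Xr ≤I R₂
  finite-on-A n rep covers-A with distinct-representatives em Xr (isEq X) n rep
  ... | zero , r , covers , distinct =
    FinitelyManyOnA.X≤I-R₂ 0 r distinct (λ _ → 0) (C-const 0)
      (λ x ax → ⊥-elim (no-Fin0 (proj₁ (covers (proj₁ (covers-A x ax))))))
    where
      no-Fin0 : Fin 0 → ⊥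
      no-Fin0 ()
  ... | suc m , r , covers , distinct =
    FinitelyManyOnA.X≤I-R₂ (suc m) r distinct Cl.classOf Cl.C-classOf cls-spec
    where
      g : ℕ → ℕ
      g = retract (r zero)

      covers-A' : ∀ x → InA x → Σ (Fin (suc m)) λ j → Xr x (r j)
      covers-A' x ax with covers-A x ax
      ... | i , xi = proj₁ (covers i) , X-trans xi (proj₂ (covers i))

      covers-g : ∀ x → Σ (Fin (suc m)) λ j → Xr (g x) (r j)
      covers-g x with retract-cases (r zero) x
      ... | inj₁ (ax , gx) rewrite gx = covers-A' x ax
      ... | inj₂ gx rewrite gx = zero , X-refl

      module Cl = Classify Xr (proj₁ (isCE X)) (proj₂ (isCE X)) (suc m) r g (C-retract (r zero)) covers-g

      cls-spec : ∀ x → InA x → Σ (Fin (suc m)) λ j → Cl.classOf x ≡ toℕ j × Xr x (r j)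
      cls-spec x ax with Cl.classOf-spec x
      ... | j , cj , gj = j , cj , subst (λ t → Xr t (r j)) (retract-A (r zero) x ax) gj

  ThroughA : Set
  ThroughA = ∃ λ k₁ → Σ (ℕ → ℕ) λ p → Computable p × Reduces R₁ (Xr ⊕ IdMod (suc k₁)) p ×
             (∀ u t → p u ≡ dbl t → InA t)

  private
    module RestrictToA (a₀ : ℕ) (aa₀ : InA a₀) where
      gA : ℕ → ℕ
      gA = retract a₀

      gA-A : ∀ x → InA (gA x)
      gA-A x with retract-cases a₀ x
      ... | inj₁ (ax , gx) rewrite gx = ax
      ... | inj₂ gx rewrite gx = aa₀

      XA : Ceer
      XA = pullback X gA (C-retract a₀)

      h : ℕ → ℕ
      h x = f (gA x) / 2 / 2

      h-spec : ∀ x → f (gA x) ≡ encP (pA (h x))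
      h-spec x with gA-A x
      ... | a , e = trans e (cong (λ t → encP (pA t)) (sym (trans (cong (λ t → t / 2 / 2) e) (pA-index a))))

      XA≤I-R₁ : rel XA ≤I R₁
      XA≤I-R₁ = 0 , h , C-∘ C-/2 (C-∘ C-/2 (C-∘ Cf (C-retract a₀))) ,
                λ x y → f-parts (gA x) (gA y) (pA (h x)) (pA (h y)) (h-spec x) (h-spec y)

      finite-XA : Finite (rel XA) → Xr ≤I R₂
      finite-XA (n , rep , covers) = finite-on-A n (λ i → gA (rep i)) covers-A
        where
          covers-A : ∀ x → InA x → Σ (Fin n) λ i → Xr x (gA (rep i))
          covers-A x ax with covers x
          ... | i , xi = i , subst (λ t → Xr t (gA (rep i))) (retract-A a₀ x ax) xi

      through-A : R₁ ≤I rel XA → ThroughA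
      through-A (k₀ , R₁≤XA) with ≤I-positive {S = rel XA} k₀ R₁≤XA
      ... | k₁ , p , Cp , rp =
        k₁ , (λ u → mapLeft gA (p u)) , C-∘ (C-mapLeft (C-retract a₀)) Cp ,
        Reduces-∘ {S = rel XA ⊕ IdMod (suc k₁)} {Xr ⊕ IdMod (suc k₁)} {p} {mapLeft gA} rp
          (mapLeft-reduces (rel XA) Xr (IdMod (suc k₁)) gA (λ a b → (λ t → t) , (λ t → t))) ,
        lands-in-A
        where
          lands-in-A : ∀ u t → mapLeft gA (p u) ≡ dbl t → InA t
          lands-in-A u t e with evenOdd (p u)
          ... | inj₁ (a , e') rewrite e' | mapLeft-even gA a = subst InA (dbl-injective e) (gA-A a)
          ... | inj₂ (a , e') rewrite e' | mapLeft-odd gA a = ⊥-elim (dbl≢sdbl (sym e))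

  -- X restricted to A lies below R₁; by minimality of R₁ it has finitely
  -- many classes (so X ≤I R₂) or R₁ reduces to X through A.
  A-dichotomy : MinimalAbove R₁ → Xr ≤I R₂ ⊎ ThroughA
  A-dichotomy minimal with em {∃ InA}
  ... | no A-empty = inj₁ (finite-on-A 0 (λ ()) (λ x ax → ⊥-elim (A-empty (x , ax))))
  ... | yes (a₀ , aa₀) with minimal (RestrictToA.XA a₀ aa₀) (RestrictToA.XA≤I-R₁ a₀ aa₀)
  ...   | inj₁ finite = inj₁ (RestrictToA.finite-XA a₀ aa₀ finite)
  ...   | inj₂ R₁≤XA  = inj₂ (RestrictToA.through-A a₀ aa₀ R₁≤XA)

-- Apply the
-- A-dichotomy to f and, with the roles of R₁ and R₂ exchanged, to swapAB ∘ f,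
-- whose A-part is the B-part of f.  If neither yields X ≤I R₂ resp. X ≤I R₁,
-- then R₁ and R₂ reduce to X through the disjoint sets A and B, and these
-- reductions join to R₁ ⊕ R₂ ≤I X.
module CoverProperty (em : ExcludedMiddle 0ℓ) (R₁ R₂ : BinRel)
    (min₁ : MinimalAbove R₁) (min₂ : MinimalAbove R₂) (X : Ceer) (k : ℕ) (f : ℕ → ℕ)
    (Cf : Computable f) (rf : Reduces (rel X) ((R₁ ⊕ R₂) ⊕ IdMod (suc k)) f) where
  private
    module Side₁ = Analysis em R₁ R₂ X k f Cf rf
    module Side₂ = Analysis em R₂ R₁ X k (λ x → swapAB (f x)) (C-∘ C-swapAB Cf)
                     (Reduces-∘ {S = (R₁ ⊕ R₂) ⊕ IdMod (suc k)} {(R₂ ⊕ R₁) ⊕ IdMod (suc k)} {f} {swapAB}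
                        rf (swapAB-reduces R₁ R₂ k))

    A-B-apart : ∀ a b → Side₁.InA a → Side₂.InA b → ¬ rel X a b
    A-B-apart a b (a' , fa) (b' , fb) =
      proj₁ (Side₁.f-parts a b (pA a') (pB b') fa (swapAB-to-A (f b) b' fb))

    joined : Side₁.ThroughA → Side₂.ThroughA → (R₁ ⊕ R₂) ≤I rel X
    joined (k₁ , p₁ , Cp₁ , rp₁ , in-A) (k₂ , p₂ , Cp₂ , rp₂ , in-B) =
      JoinReductions.join-≤I R₁ R₂ (rel X) (IsEquivalence.sym (isEq X))
        k₁ p₁ Cp₁ rp₁ k₂ p₂ Cp₂ rp₂ (λ u v a b ea eb → A-B-apart a b (in-A u a ea) (in-B v b eb))

  cover : ¬ ((R₁ ⊕ R₂) ≤I rel X) → rel X ≤I R₁ ⊎ rel X ≤I R₂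
  cover join≰X with Side₁.A-dichotomy min₁ | Side₂.A-dichotomy min₂
  ... | inj₁ X≤R₂ | _         = inj₂ X≤R₂
  ... | inj₂ _    | inj₁ X≤R₁ = inj₁ X≤R₁
  ... | inj₂ t₁   | inj₂ t₂   = ⊥-elim (join≰X (joined t₁ t₂))

cover-property : ExcludedMiddle 0ℓ → (R₁ R₂ : BinRel) → MinimalAbove R₁ → MinimalAbove R₂ →
             (X : Ceer) → rel X <I (R₁ ⊕ R₂) → rel X ≤I R₁ ⊎ rel X ≤I R₂
cover-property em R₁ R₂ min₁ min₂ X ((k₀ , X≤) , join≰X) with ≤I-positive {S = R₁ ⊕ R₂} k₀ X≤
... | k , f , Cf , rf = CoverProperty.cover em R₁ R₂ min₁ min₂ X k f Cf rf join≰X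

incomparable : ∀ (R₁ R₂ : Ceer) → DarkMinimal R₁ → DarkMinimal R₂ → ¬ (rel R₁ ≡I rel R₂) →
               ¬ (rel R₁ ≤I rel R₂)
incomparable R₁ R₂ ((not-finite₁ , _) , _) (_ , min₂) distinct R₁≤R₂ with min₂ R₁ R₁≤R₂
... | inj₁ finite = not-finite₁ finite
... | inj₂ R₂≤R₁  = distinct (R₁≤R₂ , R₂≤R₁)

left-summand-strict : ∀ R S → ¬ (S ≤I R) → R <I (R ⊕ S)
left-summand-strict R S S≰R = (0 , ⊕-inl R S) , λ le → S≰R (≤c-≤I-trans {S = R ⊕ S} (⊕-inr R S) le)

right-summand-strict : ∀ R S → ¬ (R ≤I S) → S <I (R ⊕ S)
right-summand-strict R S R≰S = (0 , ⊕-inr R S) , λ le → R≰S (≤c-≤I-trans {S = R ⊕ S} (⊕-inl R S) le)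

lemma3p9 : ExcludedMiddle 0ℓ →
    (R₁ R₂ : Ceer) → DarkMinimal R₁ → DarkMinimal R₂ →
    ¬ (rel R₁ ≡I rel R₂) →
    StronglyMinimalCover (rel R₁ ⊕ rel R₂) (rel R₁) (rel R₂)
lemma3p9 em R₁ R₂ dm₁ dm₂ distinct =
  R₁≰R₂ , R₂≰R₁ ,
  left-summand-strict (rel R₁) (rel R₂) R₂≰R₁ ,
  right-summand-strict (rel R₁) (rel R₂) R₁≰R₂ ,
  cover-property em (rel R₁) (rel R₂) (proj₂ dm₁) (proj₂ dm₂)
  where
    R₁≰R₂ : ¬ (rel R₁ ≤I rel R₂)
    R₁≰R₂ = incomparable R₁ R₂ dm₁ dm₂ distinct
    R₂≰R₁ : ¬ (rel R₂ ≤I rel R₁)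
    R₂≰R₁ = incomparable R₂ R₁ dm₂ dm₁ (λ { (le , ge) → distinct (ge , le) })
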